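{- In $\mathbb{Q}[x,y][[t]]$, define \[ g_{\mathbb{A}}=\sum_{m\ge0}\sum_{k\ge0}\frac{1}{k+m+1}\binom{2k+m}{k}\binom{k+m-1}{k-1}x^kt^{2k+m},\qquad G_{\mathbb{A}}=\sum_{m,k,\ell\ge0}\frac{\ell+1}{\ell+k+m+1}\binom{\ell+2k+m}{k}\binom{k+m-1}{k-1}x^ky^\ell t^{2k+m+\ell}, \] \[ g_{\mathbb{B}}=\sum_{m\ge0}\sum_{k\ge0}\binom{2k+m}{k}\binom{k+m-1}{k-1}x^kt^{2k+m},\qquad G_{\mathbb{B}}=\sum_{m,k,\ell\ge0}\binom{2k+\ell+m}{k}\binom{k+m-1}{k-1}x^ky^\ell t^{2k+\ell+m}. \] Then \[ G_{\mathbb{B}}=g_{\mathbb{B}}+yt\,g_{\mathbb{A}}G_{\mathbb{B}}\quad\text{and}\quad G_{\mathbb{B}}=g_{\mathbb{B}}+yt\,g_{\mathbb{B}}G_{\mathbb{A}}. \]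
   Context: Binomial coefficients with lower index $-1$ follow the convention $\binom{ -1}{ -1}=1$ and $\binom{a}{ -1}=0$ for $a\ge 0$. -}

module Defs where

open import Data.Nat using (ℕ; zero; suc; _+_; _*_; _∸_; _≤ᵇ_)
open import Data.Nat.Combinatorics using (_C_)
open import Data.Integer using (+_)
open import Data.Rational using (ℚ; 0ℚ; _/_) renaming (_+_ to _+ℚ_; _*_ to _*ℚ_)
open import Data.Bool using (if_then_else_)

-- A series in ℚ[x,y][[t]] is represented by its coefficient function:
-- F i j n = coefficient of x^i y^j t^n.
Series : Set
Series = ℕ → ℕ → ℕ → ℚ

sumTo : ℕ → (ℕ → ℚ) → ℚ
sumTo zero    f = f 0
sumTo (suc n) f = sumTo n f +ℚ f (suc n)

_⋆_ : Series → Series → Series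
(F ⋆ G) i j n =
  sumTo i λ a → sumTo j λ b → sumTo n λ c →
    F a b c *ℚ G (i ∸ a) (j ∸ b) (n ∸ c)

_⊕_ : Series → Series → Series
(F ⊕ G) i j n = F i j n +ℚ G i j n

yt : Series → Series
yt F i (suc j) (suc n) = F i j n
yt F i _       _       = 0ℚ

-- binom(k+m-1, k-1) with the convention binom(-1,-1)=1, binom(a,-1)=0 for a ≥ 0
binomL : ℕ → ℕ → ℕ
binomL zero    zero    = 1
binomL zero    (suc m) = 0
binomL (suc k) m       = (k + m) C k

-- f (n - e) if e ≤ n, else 0 : picks the unique m with e + m = n
at : ℕ → ℕ → (ℕ → ℚ) → ℚ
at n e f = if e ≤ᵇ n then f (n ∸ e) else 0ℚ

-- g_A : coefficient of x^k y^l t^n ; m = n - 2k, only l = 0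
gA : Series
gA k zero    n = at n (2 * k) λ m →
  (+ (((2 * k + m) C k) * binomL k m)) / suc (k + m)
gA k (suc l) n = 0ℚ

-- G_A : m = n - 2k - l
GA : Series
GA k l n = at n (2 * k + l) λ m →
  (+ ((suc l * ((l + 2 * k + m) C k)) * binomL k m)) / suc (l + k + m)

gB : Series
gB k zero    n = at n (2 * k) λ m →
  (+ (((2 * k + m) C k) * binomL k m)) / 1
gB k (suc l) n = 0ℚ

GB : Series
GB k l n = at n (2 * k + l) λ m →
  (+ (((2 * k + l + m) C k) * binomL k m)) / 1

-- Write F_l ∈ ℚ[[x]][[t]] for the coefficient of y^l in F ∈ ℚ[[x,y]][[t]]. Pascal's rule makes
-- the coefficient arrays of G_B, and of G_A (a difference of two Pascal-type arrays by a
-- ballot-number identity), solutions of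
--   (1 + x t) F_{l+2} + t F_l = (1 + t) F_{l+1}   with   F_l = O(t^l).
-- For two such solutions the Casoratian F_1 G_0 - F_0 G_1 vanishes, since the recurrence expresses
-- it through the Casoratian of the shifted solutions, whose order in t is larger. For Z = G_A the
-- initial relation (1 + t) Z_0 = 1 + (1 + x t) Z_1 then gives Z_1 = t Z_0^2, shows that Z_0 is
-- cancellable, and yields W_{l+1} = t Z_0 W_l for every solution W. With Z_0 = g_A and
-- (G_B)_0 = g_B this reads (G_B)_{l+1} = t g_A (G_B)_l = t g_B (G_A)_l.

module Submission where

open import Level using (0ℓ)
open import Function using (_∘_)
open import Data.Nat using (ℕ; zero; suc; _∸_; _<_; _≤_; z≤n; s≤s)
import Data.Nat as ℕ
open import Data.Nat.Properties using (≤-trans; n≤1+n)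
open import Data.Product using (_×_; _,_)
open import Relation.Binary using (IsEquivalence)
open import Algebra.Bundles using (CommutativeSemiring; CommutativeRing)
open import Algebra.Definitions using (RightCancellative)
import Algebra.Structures.Biased as Biased

module PowerSeries {c ℓ} (R : CommutativeSemiring c ℓ) where

  open CommutativeSemiring R
  open import Algebra.Properties.CommutativeSemigroup +-commutativeSemigroup using (interchange)
  open import Relation.Binary.Reasoning.Setoid setoid

  Series : Set c
  Series = ℕ → Carrier

  infix  4 _≋_
  infixl 6 _+ₛ_
  infixl 7 _*ₛ_ _·_

  _≋_ : Series → Series → Set ℓ
  f ≋ g = ∀ n → f n ≈ g n

  _+ₛ_ : Series → Series → Series
  (f +ₛ g) n = f n + g n

  _·_ : Carrier → Series → Series
  (a · f) n = a * f n

  constant : Carrier → Series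
  constant a zero    = a
  constant a (suc n) = 0#

  0ₛ 1ₛ X : Series
  0ₛ _ = 0#
  1ₛ = constant 1#
  X zero    = 0#
  X (suc n) = 1ₛ n

  shift : Series → Series
  shift f zero    = 0#
  shift f (suc n) = f n

  _*ₛ_ : Series → Series → Series
  (f *ₛ g) zero    = f 0 * g 0
  (f *ₛ g) (suc n) = f 0 * g (suc n) + (f ∘ suc *ₛ g) n

  *ₛ-cong : ∀ {f f′ g g′} → f ≋ f′ → g ≋ g′ → f *ₛ g ≋ f′ *ₛ g′
  *ₛ-cong p q zero    = *-cong (p 0) (q 0)
  *ₛ-cong p q (suc n) = +-cong (*-cong (p 0) (q (suc n))) (*ₛ-cong (p ∘ suc) q n)

  *ₛ-zeroˡ : ∀ g → 0ₛ *ₛ g ≋ 0ₛ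
  *ₛ-zeroˡ g zero    = zeroˡ (g 0)
  *ₛ-zeroˡ g (suc n) = trans (+-cong (zeroˡ (g (suc n))) (*ₛ-zeroˡ g n)) (+-identityˡ 0#)

  *ₛ-identityˡ : ∀ f → 1ₛ *ₛ f ≋ f
  *ₛ-identityˡ f zero    = *-identityˡ (f 0)
  *ₛ-identityˡ f (suc n) = trans (+-cong (*-identityˡ (f (suc n))) (*ₛ-zeroˡ f n)) (+-identityʳ _)

  constant-*ₛ : ∀ a f → constant a *ₛ f ≋ a · f
  constant-*ₛ a f zero    = refl
  constant-*ₛ a f (suc n) = trans (+-congˡ (*ₛ-zeroˡ f n)) (+-identityʳ _)

  X-*ₛ : ∀ f → X *ₛ f ≋ shift f
  X-*ₛ f zero    = zeroˡ (f 0)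
  X-*ₛ f (suc n) = trans (+-cong (zeroˡ (f (suc n))) (*ₛ-identityˡ f n)) (+-identityˡ (f n))

  ·-*ₛ : ∀ a f g → a · f *ₛ g ≋ a · (f *ₛ g)
  ·-*ₛ a f g zero    = *-assoc a (f 0) (g 0)
  ·-*ₛ a f g (suc n) = trans (+-cong (*-assoc a (f 0) _) (·-*ₛ a (f ∘ suc) g n)) (sym (distribˡ a _ _))

  *ₛ-distribʳ : ∀ h f g → (f +ₛ g) *ₛ h ≋ f *ₛ h +ₛ g *ₛ h
  *ₛ-distribʳ h f g zero    = distribʳ (h 0) (f 0) (g 0)
  *ₛ-distribʳ h f g (suc n) = begin
    (f 0 + g 0) * h (suc n) + ((f ∘ suc +ₛ g ∘ suc) *ₛ h) n
      ≈⟨ +-cong (distribʳ (h (suc n)) (f 0) (g 0)) (*ₛ-distribʳ h (f ∘ suc) (g ∘ suc) n) ⟩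
    (f 0 * h (suc n) + g 0 * h (suc n)) + ((f ∘ suc *ₛ h) n + (g ∘ suc *ₛ h) n)
      ≈⟨ interchange _ _ _ _ ⟩
    (f 0 * h (suc n) + (f ∘ suc *ₛ h) n) + (g 0 * h (suc n) + (g ∘ suc *ₛ h) n) ∎

  *ₛ-assoc : ∀ f g h → (f *ₛ g) *ₛ h ≋ f *ₛ (g *ₛ h)
  *ₛ-assoc f g h zero    = *-assoc (f 0) (g 0) (h 0)
  *ₛ-assoc f g h (suc n) = begin
    (f 0 * g 0) * h (suc n) + ((f 0 · g ∘ suc +ₛ f ∘ suc *ₛ g) *ₛ h) n
      ≈⟨ +-congˡ (trans (*ₛ-distribʳ h (f 0 · g ∘ suc) (f ∘ suc *ₛ g) n)
                        (+-cong (·-*ₛ (f 0) (g ∘ suc) h n) (*ₛ-assoc (f ∘ suc) g h n))) ⟩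
    (f 0 * g 0) * h (suc n) + (f 0 * (g ∘ suc *ₛ h) n + (f ∘ suc *ₛ (g *ₛ h)) n)
      ≈⟨ sym (+-assoc _ _ _) ⟩
    ((f 0 * g 0) * h (suc n) + f 0 * (g ∘ suc *ₛ h) n) + (f ∘ suc *ₛ (g *ₛ h)) n
      ≈⟨ +-congʳ (trans (+-congʳ (*-assoc (f 0) (g 0) (h (suc n)))) (sym (distribˡ (f 0) _ _))) ⟩
    f 0 * (g *ₛ h) (suc n) + (f ∘ suc *ₛ (g *ₛ h)) n ∎

  *ₛ-unfoldʳ : ∀ f g n → (f *ₛ g) (suc n) ≈ (f *ₛ g ∘ suc) n + f (suc n) * g 0
  *ₛ-unfoldʳ f g zero    = refl
  *ₛ-unfoldʳ f g (suc n) =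
    trans (+-congˡ (*ₛ-unfoldʳ (f ∘ suc) g n)) (sym (+-assoc _ _ _))

  *ₛ-comm : ∀ f g → f *ₛ g ≋ g *ₛ f
  *ₛ-comm f g zero    = *-comm (f 0) (g 0)
  *ₛ-comm f g (suc n) = begin
    f 0 * g (suc n) + (f ∘ suc *ₛ g) n   ≈⟨ +-cong (*-comm (f 0) (g (suc n))) (*ₛ-comm (f ∘ suc) g n) ⟩
    g (suc n) * f 0 + (g *ₛ f ∘ suc) n   ≈⟨ +-comm _ _ ⟩
    (g *ₛ f ∘ suc) n + g (suc n) * f 0   ≈⟨ sym (*ₛ-unfoldʳ g f n) ⟩
    (g *ₛ f) (suc n)                     ∎

  ≋-isEquivalence : IsEquivalence _≋_
  ≋-isEquivalence = record
    { refl = λ _ → refl ; sym = λ p n → sym (p n) ; trans = λ p q n → trans (p n) (q n) }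

  commutativeSemiring : CommutativeSemiring c ℓ
  commutativeSemiring = record
    { isCommutativeSemiring = Biased.isCommutativeSemiringˡ record
      { +-isCommutativeMonoid = record
        { isMonoid = record
          { isSemigroup = record
            { isMagma = record
              { isEquivalence = ≋-isEquivalence ; ∙-cong = λ p q n → +-cong (p n) (q n) }
            ; assoc = λ f g h n → +-assoc (f n) (g n) (h n) }
          ; identity = (λ f n → +-identityˡ (f n)) , (λ f n → +-identityʳ (f n)) }
        ; comm = λ f g n → +-comm (f n) (g n) }
      ; *-isCommutativeMonoid = record
        { isMonoid = record
          { isSemigroup = record
            { isMagma = record { isEquivalence = ≋-isEquivalence ; ∙-cong = *ₛ-cong }
            ; assoc = *ₛ-assoc }
          ; identity = *ₛ-identityˡ , λ f n → trans (*ₛ-comm f 1ₛ n) (*ₛ-identityˡ f n) }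
        ; comm = *ₛ-comm }
      ; distribʳ = *ₛ-distribʳ
      ; zeroˡ = *ₛ-zeroˡ
      }
    }

  +ₛ-cancelʳ : RightCancellative _≈_ _+_ → RightCancellative _≋_ _+ₛ_
  +ₛ-cancelʳ cancel h f g p n = cancel (h n) (f n) (g n) (p n)

  HasOrder : ℕ → Series → Set ℓ
  HasOrder p f = ∀ n → n < p → f n ≈ 0#

  *ₛ-orderʳ : ∀ {q} f g → HasOrder q g → HasOrder q (f *ₛ g)
  *ₛ-orderʳ f g og zero    0<q = trans (*-congˡ (og 0 0<q)) (zeroʳ (f 0))
  *ₛ-orderʳ f g og (suc n) n<q = trans
    (+-cong (trans (*-congˡ (og (suc n) n<q)) (zeroʳ (f 0)))
            (*ₛ-orderʳ (f ∘ suc) g og n (≤-trans (n≤1+n (suc n)) n<q)))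
    (+-identityˡ 0#)

  *ₛ-order : ∀ {p q} f g → HasOrder p f → HasOrder q g → HasOrder (p ℕ.+ q) (f *ₛ g)
  *ₛ-order {zero}  f g of og n n<q = *ₛ-orderʳ f g og n n<q
  *ₛ-order {suc p} f g of og zero    _ = trans (*-congʳ (of 0 (s≤s z≤n))) (zeroˡ (g 0))
  *ₛ-order {suc p} f g of og (suc n) (s≤s n<p+q) = trans
    (+-cong (trans (*-congʳ (of 0 (s≤s z≤n))) (zeroˡ _))
            (*ₛ-order (f ∘ suc) g (λ m m<p → of (suc m) (s≤s m<p)) og n n<p+q))
    (+-identityˡ 0#)

  ∑≤ : ℕ → (ℕ → Carrier) → Carrier
  ∑≤ zero    h = h 0
  ∑≤ (suc n) h = ∑≤ n h + h (suc n)

  ∑≤-suc-front : ∀ n h → ∑≤ (suc n) h ≈ h 0 + ∑≤ n (h ∘ suc)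
  ∑≤-suc-front zero    h = refl
  ∑≤-suc-front (suc n) h = trans (+-congʳ (∑≤-suc-front n h)) (+-assoc _ _ _)

  *ₛ-coeff : ∀ f g n → (f *ₛ g) n ≈ ∑≤ n (λ i → f i * g (n ∸ i))
  *ₛ-coeff f g zero    = refl
  *ₛ-coeff f g (suc n) =
    trans (+-congˡ (*ₛ-coeff (f ∘ suc) g n)) (sym (∑≤-suc-front n (λ i → f i * g (suc n ∸ i))))

module LinearRecurrence {c ℓ} (R : CommutativeSemiring c ℓ)
  (+-cancelʳ : RightCancellative (CommutativeSemiring._≈_ R) (CommutativeSemiring._+_ R))
  (a : CommutativeSemiring.Carrier R) where

  open CommutativeSemiring R using (_≈_; _+_; _*_)

  open PowerSeries R
  private
    module R = CommutativeSemiring R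
    module S = CommutativeSemiring commutativeSemiring
  open S using (+-cong; +-congˡ; +-congʳ; *-congˡ; *-congʳ; setoid)
  open import Relation.Binary.Reasoning.Setoid setoid
  open import Algebra.Solver.Ring.NaturalCoefficients.Default commutativeSemiring
  open import Data.Nat.Properties using (+-suc; +-identityʳ; n<1+n; m≤m+n; <-≤-trans; ≤-trans; n≤1+n; m<n⇒m<1+n)
  open import Relation.Binary.PropositionalEquality using (subst; cong)
  import Relation.Binary.PropositionalEquality as ≡

  U V : Series
  U = 1ₛ +ₛ constant a *ₛ X
  V = 1ₛ +ₛ X

  Recurrence : (ℕ → Series) → Set ℓ
  Recurrence F = ∀ l → U *ₛ F (suc (suc l)) +ₛ X *ₛ F l ≋ V *ₛ F (suc l)

  HasOrders : (ℕ → Series) → Set ℓ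
  HasOrders F = ∀ l → HasOrder l (F l)

  U-*ₛ-coeff : ∀ f n → (U *ₛ f) n ≈ f n + a * shift f n
  U-*ₛ-coeff f n = R.trans (*ₛ-distribʳ f 1ₛ (constant a *ₛ X) n)
    (R.+-cong (*ₛ-identityˡ f n)
      (R.trans (*ₛ-assoc (constant a) X f n)
        (R.trans (constant-*ₛ a (X *ₛ f) n) (R.*-congˡ (X-*ₛ f n)))))

  V-*ₛ-coeff : ∀ f n → (V *ₛ f) n ≈ f n + shift f n
  V-*ₛ-coeff f n = R.trans (*ₛ-distribʳ f 1ₛ X n) (R.+-cong (*ₛ-identityˡ f n) (X-*ₛ f n))

  private
    +-cancelˡ : ∀ x y z → x + y ≈ x + z → y ≈ z
    +-cancelˡ x y z p = +-cancelʳ x y z (R.trans (R.+-comm y x) (R.trans p (R.+-comm x z)))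

    S-cancelˡ : ∀ f g h → f +ₛ g ≋ f +ₛ h → g ≋ h
    S-cancelˡ f g h p n = +-cancelˡ (f n) (g n) (h n) (p n)

    S-cancelʳ : ∀ f g h → g +ₛ f ≋ h +ₛ f → g ≋ h
    S-cancelʳ = +ₛ-cancelʳ +-cancelʳ

  HasOrder-≤ : ∀ {p q} f → p ≤ q → HasOrder q f → HasOrder p f
  HasOrder-≤ f p≤q o n n<p = o n (<-≤-trans n<p p≤q)

  HasOrder-cancel : ∀ {p f h g} → f +ₛ h ≋ g → HasOrder p h → HasOrder p g → HasOrder p f
  HasOrder-cancel {h = h} fh≋g oh og n n<p = +-cancelʳ (h n) _ _
    (R.trans (fh≋g n) (R.trans (og n n<p) (R.trans (R.sym (R.+-identityˡ _)) (R.+-congˡ (R.sym (oh n n<p))))))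

  recurrence-cancel : ∀ {Z H G} → (∀ l → Z l +ₛ H l ≋ G l) → Recurrence H → Recurrence G → Recurrence Z
  recurrence-cancel {Z} {H} {G} ZH≋G recH recG l = S-cancelʳ (U *ₛ H₂ +ₛ X *ₛ H₀) _ _ (begin
    U *ₛ Z₂ +ₛ X *ₛ Z₀ +ₛ (U *ₛ H₂ +ₛ X *ₛ H₀)
      ≈⟨ solve 6 (λ u x z₂ z₀ h₂ h₀ → u :* z₂ :+ x :* z₀ :+ (u :* h₂ :+ x :* h₀) := u :* (z₂ :+ h₂) :+ x :* (z₀ :+ h₀))
                 S.refl U X Z₂ Z₀ H₂ H₀ ⟩
    U *ₛ (Z₂ +ₛ H₂) +ₛ X *ₛ (Z₀ +ₛ H₀)   ≈⟨ +-cong (*-congˡ (ZH≋G (suc (suc l)))) (*-congˡ (ZH≋G l)) ⟩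
    U *ₛ G (suc (suc l)) +ₛ X *ₛ G l     ≈⟨ recG l ⟩
    V *ₛ G (suc l)                       ≈⟨ *-congˡ (ZH≋G (suc l)) ⟨
    V *ₛ (Z (suc l) +ₛ H (suc l))        ≈⟨ S.distribˡ V (Z (suc l)) (H (suc l)) ⟩
    V *ₛ Z (suc l) +ₛ V *ₛ H (suc l)     ≈⟨ +-congˡ (recH l) ⟨
    V *ₛ Z (suc l) +ₛ (U *ₛ H₂ +ₛ X *ₛ H₀) ∎)
    where
    Z₀ = Z l ; Z₂ = Z (suc (suc l)) ; H₀ = H l ; H₂ = H (suc (suc l))

  initial-cancel : ∀ {Z H G : ℕ → Series} → (∀ l → Z l +ₛ H l ≋ G l) →
                   V *ₛ G 0 +ₛ U *ₛ H 1 ≋ 1ₛ +ₛ U *ₛ G 1 +ₛ V *ₛ H 0 → V *ₛ Z 0 ≋ 1ₛ +ₛ U *ₛ Z 1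
  initial-cancel {Z} {H} {G} ZH≋G initGH = S-cancelʳ (V *ₛ H 0 +ₛ U *ₛ H 1) _ _ (begin
    V *ₛ Z 0 +ₛ (V *ₛ H 0 +ₛ U *ₛ H 1)
      ≈⟨ solve 5 (λ v u z₀ h₀ h₁ → v :* z₀ :+ (v :* h₀ :+ u :* h₁) := v :* (z₀ :+ h₀) :+ u :* h₁)
                 S.refl V U (Z 0) (H 0) (H 1) ⟩
    V *ₛ (Z 0 +ₛ H 0) +ₛ U *ₛ H 1          ≈⟨ +-congʳ (*-congˡ (ZH≋G 0)) ⟩
    V *ₛ G 0 +ₛ U *ₛ H 1                   ≈⟨ initGH ⟩
    1ₛ +ₛ U *ₛ G 1 +ₛ V *ₛ H 0             ≈⟨ +-congʳ (+-congˡ (*-congˡ (ZH≋G 1))) ⟨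
    1ₛ +ₛ U *ₛ (Z 1 +ₛ H 1) +ₛ V *ₛ H 0
      ≈⟨ solve 6 (λ o v u z₁ h₀ h₁ → o :+ u :* (z₁ :+ h₁) :+ v :* h₀ := o :+ u :* z₁ :+ (v :* h₀ :+ u :* h₁))
                 S.refl 1ₛ V U (Z 1) (H 0) (H 1) ⟩
    1ₛ +ₛ U *ₛ Z 1 +ₛ (V *ₛ H 0 +ₛ U *ₛ H 1) ∎)

  casoratian : ∀ {F G} → Recurrence F → Recurrence G → HasOrders F → HasOrders G →
               F 1 *ₛ G 0 ≋ F 0 *ₛ G 1
  casoratian {F} {G} recF recG ordF ordG n = agree (suc n) 0 n (n<1+n n)
    where
    P Q : ℕ → Series
    P m = F (suc m) *ₛ G m
    Q m = F m *ₛ G (suc m)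

    exchange : ∀ m → U *ₛ P (suc m) +ₛ X *ₛ Q m ≋ U *ₛ Q (suc m) +ₛ X *ₛ P m
    exchange m = begin
      U *ₛ (F₂ *ₛ G₁) +ₛ X *ₛ (F₀ *ₛ G₁)
        ≈⟨ solve 5 (λ u x f₂ f₀ g₁ → u :* (f₂ :* g₁) :+ x :* (f₀ :* g₁) := (u :* f₂ :+ x :* f₀) :* g₁)
                   S.refl U X F₂ F₀ G₁ ⟩
      (U *ₛ F₂ +ₛ X *ₛ F₀) *ₛ G₁   ≈⟨ *-congʳ (recF m) ⟩
      V *ₛ F₁ *ₛ G₁                ≈⟨ solve 3 (λ v f₁ g₁ → v :* f₁ :* g₁ := f₁ :* (v :* g₁)) S.refl V F₁ G₁ ⟩
      F₁ *ₛ (V *ₛ G₁)              ≈⟨ *-congˡ (recG m) ⟨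
      F₁ *ₛ (U *ₛ G₂ +ₛ X *ₛ G₀)
        ≈⟨ solve 5 (λ u x f₁ g₂ g₀ → f₁ :* (u :* g₂ :+ x :* g₀) := u :* (f₁ :* g₂) :+ x :* (f₁ :* g₀))
                   S.refl U X F₁ G₂ G₀ ⟩
      U *ₛ (F₁ *ₛ G₂) +ₛ X *ₛ (F₁ *ₛ G₀) ∎
      where
      F₀ = F m ; F₁ = F (suc m) ; F₂ = F (suc (suc m))
      G₀ = G m ; G₁ = G (suc m) ; G₂ = G (suc (suc m))

    exchange-coeff : ∀ m n → P (suc m) (suc n) + a * P (suc m) n + Q m n
                           ≈ Q (suc m) (suc n) + a * Q (suc m) n + P m n
    exchange-coeff m n = R.trans (R.sym (R.+-cong (U-*ₛ-coeff (P (suc m)) (suc n)) (X-*ₛ (Q m) (suc n))))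
      (R.trans (exchange m (suc n)) (R.+-cong (U-*ₛ-coeff (Q (suc m)) (suc n)) (X-*ₛ (P m) (suc n))))

    -- Coefficient n at level m is fixed by coefficients n and n + 1 at level m + 1, and both
    -- P m and Q m vanish below degree 2m + 1.
    agree : ∀ d m n → n < m ℕ.+ m ℕ.+ d → P m n ≈ Q m n
    agree zero m n n<2m = R.trans
      (*ₛ-order (F (suc m)) (G m) (ordF (suc m)) (ordG m) n n<1+2m)
      (R.sym (*ₛ-order (F m) (G (suc m)) (ordF m) (ordG (suc m)) n
        (subst (n <_) (≡.sym (+-suc m m)) n<1+2m)))
      where
      n<1+2m : n < suc (m ℕ.+ m)
      n<1+2m = m<n⇒m<1+n (subst (n <_) (+-identityʳ (m ℕ.+ m)) n<2m)
    agree (suc d) m n n<2m+d = R.sym (+-cancelˡ _ _ _ (R.trans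
      (R.sym (R.+-cong (R.+-cong (agree d (suc m) (suc n) 1+n<) (R.*-congˡ (agree d (suc m) n n<))) R.refl))
      (exchange-coeff m n)))
      where
      1+n< : suc n < suc m ℕ.+ suc m ℕ.+ d
      1+n< = s≤s (subst (n <_) (≡.sym (≡.trans (cong (ℕ._+ d) (+-suc m m)) (≡.sym (+-suc (m ℕ.+ m) d)))) n<2m+d)
      n< : n < suc m ℕ.+ suc m ℕ.+ d
      n< = ≤-trans (n≤1+n (suc n)) 1+n<

  private
    *-1+ : ∀ f g → f *ₛ (1ₛ +ₛ g) ≋ f +ₛ f *ₛ g
    *-1+ f g = S.trans (S.distribˡ f 1ₛ g) (+-congʳ (S.*-identityʳ f))

  module _ {Z : ℕ → Series} (recZ : Recurrence Z) (ordZ : HasOrders Z)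
           (initZ : V *ₛ Z 0 ≋ 1ₛ +ₛ U *ₛ Z 1) where

    private
      Z₀ = Z 0
      Z₁ = Z 1

    Z₁≋XZ₀² : Z₁ ≋ X *ₛ (Z₀ *ₛ Z₀)
    Z₁≋XZ₀² = S.sym (S-cancelˡ (U *ₛ (Z₁ *ₛ Z₁)) _ _ (begin
      U *ₛ (Z₁ *ₛ Z₁) +ₛ X *ₛ (Z₀ *ₛ Z₀)   ≈⟨ +-congʳ (*-congˡ Z₂Z₀≋Z₁Z₁) ⟨
      U *ₛ (Z 2 *ₛ Z₀) +ₛ X *ₛ (Z₀ *ₛ Z₀)
        ≈⟨ solve 4 (λ u x z₂ z₀ → u :* (z₂ :* z₀) :+ x :* (z₀ :* z₀) := (u :* z₂ :+ x :* z₀) :* z₀)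
                   S.refl U X (Z 2) Z₀ ⟩
      (U *ₛ Z 2 +ₛ X *ₛ Z₀) *ₛ Z₀          ≈⟨ *-congʳ (recZ 0) ⟩
      V *ₛ Z₁ *ₛ Z₀                        ≈⟨ solve 3 (λ v z₁ z₀ → v :* z₁ :* z₀ := z₁ :* (v :* z₀)) S.refl V Z₁ Z₀ ⟩
      Z₁ *ₛ (V *ₛ Z₀)                      ≈⟨ *-congˡ initZ ⟩
      Z₁ *ₛ (1ₛ +ₛ U *ₛ Z₁)                ≈⟨ *-1+ Z₁ (U *ₛ Z₁) ⟩
      Z₁ +ₛ Z₁ *ₛ (U *ₛ Z₁)
        ≈⟨ solve 2 (λ u z₁ → z₁ :+ z₁ :* (u :* z₁) := u :* (z₁ :* z₁) :+ z₁) S.refl U Z₁ ⟩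
      U *ₛ (Z₁ *ₛ Z₁) +ₛ Z₁                ∎))
      where
      Z₂Z₀≋Z₁Z₁ : Z 2 *ₛ Z₀ ≋ Z₁ *ₛ Z₁
      Z₂Z₀≋Z₁Z₁ = casoratian (recZ ∘ suc) recZ (λ m → HasOrder-≤ (Z (suc m)) (n≤1+n m) (ordZ (suc m))) ordZ

    cancel-Z₀ : ∀ A B → A *ₛ Z₀ ≋ B *ₛ Z₀ → A ≋ B
    cancel-Z₀ A B AZ₀≋BZ₀ = S-cancelʳ (A *ₛ Z₀ *ₛ Y) A B (begin
      A +ₛ A *ₛ Z₀ *ₛ Y      ≈⟨ +-congˡ (S.*-assoc A Z₀ Y) ⟩
      A +ₛ A *ₛ (Z₀ *ₛ Y)    ≈⟨ *-1+ A (Z₀ *ₛ Y) ⟨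
      A *ₛ (1ₛ +ₛ Z₀ *ₛ Y)   ≈⟨ *-congˡ VZ₀≋1+Z₀Y ⟨
      A *ₛ (V *ₛ Z₀)         ≈⟨ solve 3 (λ a v z → a :* (v :* z) := a :* z :* v) S.refl A V Z₀ ⟩
      A *ₛ Z₀ *ₛ V           ≈⟨ *-congʳ AZ₀≋BZ₀ ⟩
      B *ₛ Z₀ *ₛ V           ≈⟨ solve 3 (λ b v z → b :* z :* v := b :* (v :* z)) S.refl B V Z₀ ⟩
      B *ₛ (V *ₛ Z₀)         ≈⟨ *-congˡ VZ₀≋1+Z₀Y ⟩
      B *ₛ (1ₛ +ₛ Z₀ *ₛ Y)   ≈⟨ *-1+ B (Z₀ *ₛ Y) ⟩
      B +ₛ B *ₛ (Z₀ *ₛ Y)    ≈⟨ +-congˡ (S.*-assoc B Z₀ Y) ⟨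
      B +ₛ B *ₛ Z₀ *ₛ Y      ≈⟨ +-congˡ (*-congʳ AZ₀≋BZ₀) ⟨
      B +ₛ A *ₛ Z₀ *ₛ Y      ∎)
      where
      Y : Series
      Y = U *ₛ (X *ₛ Z₀)

      VZ₀≋1+Z₀Y : V *ₛ Z₀ ≋ 1ₛ +ₛ Z₀ *ₛ Y
      VZ₀≋1+Z₀Y = begin
        V *ₛ Z₀                         ≈⟨ initZ ⟩
        1ₛ +ₛ U *ₛ Z₁                   ≈⟨ +-congˡ (*-congˡ Z₁≋XZ₀²) ⟩
        1ₛ +ₛ U *ₛ (X *ₛ (Z₀ *ₛ Z₀))
          ≈⟨ +-congˡ (solve 3 (λ u x z → u :* (x :* (z :* z)) := z :* (u :* (x :* z))) S.refl U X Z₀) ⟩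
        1ₛ +ₛ Z₀ *ₛ Y                   ∎

    geometric : ∀ {W} → Recurrence W → HasOrders W → ∀ l → W (suc l) ≋ X *ₛ Z₀ *ₛ W l
    geometric {W} recW ordW l = cancel-Z₀ (W (suc l)) (X *ₛ Z₀ *ₛ W l) (begin
      W (suc l) *ₛ Z₀           ≈⟨ casoratian (λ m → recW (m ℕ.+ l)) recZ ordW+l ordZ ⟩
      W l *ₛ Z₁                 ≈⟨ *-congˡ Z₁≋XZ₀² ⟩
      W l *ₛ (X *ₛ (Z₀ *ₛ Z₀))  ≈⟨ solve 3 (λ w x z → w :* (x :* (z :* z)) := x :* z :* w :* z) S.refl (W l) X Z₀ ⟩
      X *ₛ Z₀ *ₛ W l *ₛ Z₀      ∎)
      where
      ordW+l : HasOrders (λ m → W (m ℕ.+ l))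
      ordW+l m = HasOrder-≤ (W (m ℕ.+ l)) (m≤m+n m l) (ordW (m ℕ.+ l))

    geometric-exchange : ∀ {W} → Recurrence W → HasOrders W → ∀ l → W (suc l) ≋ X *ₛ (W 0 *ₛ Z l)
    geometric-exchange {W} recW ordW zero = S.trans (geometric recW ordW 0)
      (solve 3 (λ x z w → x :* z :* w := x :* (w :* z)) S.refl X Z₀ (W 0))
    geometric-exchange {W} recW ordW (suc l) = begin
      W (suc (suc l))                  ≈⟨ geometric recW ordW (suc l) ⟩
      X *ₛ Z₀ *ₛ W (suc l)             ≈⟨ *-congˡ (geometric-exchange recW ordW l) ⟩
      X *ₛ Z₀ *ₛ (X *ₛ (W 0 *ₛ Z l))
        ≈⟨ solve 4 (λ x z₀ w₀ z → x :* z₀ :* (x :* (w₀ :* z)) := x :* (w₀ :* (x :* z₀ :* z)))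
                                               S.refl X Z₀ (W 0) (Z l) ⟩
      X *ₛ (W 0 *ₛ (X *ₛ Z₀ *ₛ Z l))   ≈⟨ *-congˡ (*-congˡ (geometric recZ ordZ l)) ⟨
      X *ₛ (W 0 *ₛ Z (suc l))          ∎

open import Data.Nat using (_+_; _*_; _≤ᵇ_)
open import Data.Nat.Properties
open import Data.Nat.Combinatorics using (_C_; nCk+nC[k+1]≡[n+1]C[k+1])
open import Data.Nat.Solver using (module +-*-Solver)
open import Relation.Binary.PropositionalEquality
open import Defs hiding (Series)
open +-*-Solver using (solve; _:=_; _:+_; _:*_; con)
open ≡-Reasoning

bin : ℕ → ℕ → ℕ
bin n       zero    = 1
bin zero    (suc k) = 0
bin (suc n) (suc k) = bin n k + bin n (suc k)

bin≡C : ∀ n k → bin n k ≡ n C k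
bin≡C n       zero    = refl
bin≡C zero    (suc k) = refl
bin≡C (suc n) (suc k) = trans (cong₂ _+_ (bin≡C n k) (bin≡C n (suc k))) (nCk+nC[k+1]≡[n+1]C[k+1] n k)

n<k⇒bin≡0 : ∀ {n k} → n < k → bin n k ≡ 0
n<k⇒bin≡0 {zero}  {suc k} _         = refl
n<k⇒bin≡0 {suc n} {suc k} (s≤s n<k) = cong₂ _+_ (n<k⇒bin≡0 n<k) (n<k⇒bin≡0 (m<n⇒m<1+n n<k))

bin[n,1]≡n : ∀ n → bin n 1 ≡ n
bin[n,1]≡n zero    = refl
bin[n,1]≡n (suc n) = cong suc (bin[n,1]≡n n)

-- bin₁₁ n k = C(n-1,k-1) under the convention C(-1,-1) = 1, and bin₀₁ n k = C(n,k-1).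
bin₁₁ bin₀₁ : ℕ → ℕ → ℕ
bin₁₁ zero    zero    = 1
bin₁₁ zero    (suc k) = 0
bin₁₁ (suc n) zero    = 0
bin₁₁ (suc n) (suc k) = bin n k
bin₀₁ n zero    = 0
bin₀₁ n (suc k) = bin n k

bin₁₁-below : ∀ {q k} → q < k → bin₁₁ q k ≡ 0
bin₁₁-below {zero}  {suc k} _         = refl
bin₁₁-below {suc q} {suc k} (s≤s q<k) = n<k⇒bin≡0 q<k

binomL≡bin₁₁ : ∀ k m → binomL k m ≡ bin₁₁ (k + m) k
binomL≡bin₁₁ zero    zero    = refl
binomL≡bin₁₁ zero    (suc m) = refl
binomL≡bin₁₁ (suc k) m       = sym (bin≡C (k + m) k)

IsPascal : (ℕ → ℕ → ℕ) → Set
IsPascal P = ∀ n k → P (suc n) (suc k) ≡ P n (suc k) + P n k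

bin-pascal : IsPascal bin
bin-pascal n k = +-comm (bin n k) (bin n (suc k))

bin₁₁-pascal : IsPascal bin₁₁
bin₁₁-pascal zero    zero    = refl
bin₁₁-pascal zero    (suc k) = refl
bin₁₁-pascal (suc n) zero    = refl
bin₁₁-pascal (suc n) (suc k) = bin-pascal n k

bin₀₁-pascal : IsPascal bin₀₁
bin₀₁-pascal n zero    = refl
bin₀₁-pascal n (suc k) = bin-pascal n k

absorption : ∀ n k → suc k * bin (suc n) (suc k) ≡ suc n * bin n k
absorption zero    zero    = refl
absorption zero    (suc k) = *-zeroʳ (suc (suc k))
absorption (suc n) zero    =
  trans (*-identityˡ _) (trans (bin[n,1]≡n (suc (suc n))) (sym (*-identityʳ (suc (suc n)))))
absorption (suc n) (suc k) = begin
  suc (suc k) * (a + b + w)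
    ≡⟨ solve 4 (λ k a b w → (con 2 :+ k) :* (a :+ b :+ w) := (a :+ b) :+ (con 1 :+ k) :* (a :+ b) :+ (con 2 :+ k) :* w)
             refl k a b w ⟩
  (a + b) + suc k * (a + b) + suc (suc k) * w
    ≡⟨ cong₂ (λ x y → (a + b) + x + y) (absorption n k) (absorption n (suc k)) ⟩
  (a + b) + suc n * a + suc n * b
    ≡⟨ solve 3 (λ n a b → (a :+ b) :+ (con 1 :+ n) :* a :+ (con 1 :+ n) :* b := (con 2 :+ n) :* (a :+ b)) refl n a b ⟩
  suc (suc n) * (a + b) ∎
  where
  a = bin n k
  b = bin n (suc k)
  w = bin (suc n) (suc (suc k))

lower-absorption : ∀ a k → suc a * bin (a + suc k) k ≡ suc k * bin (a + suc k) (suc k)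
lower-absorption a k = sym (+-cancelʳ-≡ (suc k * bin n k) _ _ (begin
  suc k * bin n (suc k) + suc k * bin n k
    ≡⟨ solve 3 (λ k x y → k :* x :+ k :* y := k :* (y :+ x)) refl (suc k) (bin n (suc k)) (bin n k) ⟩
  suc k * bin (suc n) (suc k)              ≡⟨ absorption n k ⟩
  (suc a + suc k) * bin n k                ≡⟨ *-distribʳ-+ (bin n k) (suc a) (suc k) ⟩
  suc a * bin n k + suc k * bin n k        ∎))
  where n = a + suc k

bin-ratio : ∀ {n} s k → k + suc s ≡ n → bin n (suc k) * bin s k ≡ bin n k * bin (suc s) (suc k)
bin-ratio s k k+1+s≡n = subst (λ n → bin n (suc k) * bin s k ≡ bin n k * bin (suc s) (suc k)) s+1+k≡n
  (*-cancelˡ-≡ _ _ (suc k) (begin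
    suc k * (bin N (suc k) * bin s k)        ≡⟨ *-assoc (suc k) (bin N (suc k)) (bin s k) ⟨
    suc k * bin N (suc k) * bin s k          ≡⟨ cong (_* bin s k) (lower-absorption s k) ⟨
    suc s * bin N k * bin s k
      ≡⟨ solve 3 (λ x y z → x :* y :* z := y :* (x :* z)) refl (suc s) (bin N k) (bin s k) ⟩
    bin N k * (suc s * bin s k)              ≡⟨ cong (bin N k *_) (absorption s k) ⟨
    bin N k * (suc k * bin (suc s) (suc k))
      ≡⟨ solve 3 (λ x y z → x :* (y :* z) := y :* (x :* z)) refl (bin N k) (suc k) _ ⟩
    suc k * (bin N k * bin (suc s) (suc k))  ∎))
  where
  N = s + suc k
  s+1+k≡n : N ≡ _
  s+1+k≡n = trans (solve 2 (λ s k → s :+ (con 1 :+ k) := k :+ (con 1 :+ s)) refl s k) k+1+s≡n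

ballot-identity : ∀ k l m →
  suc l * bin (k + l + (k + m)) k * bin₁₁ (k + m) k + suc (l + k + m) * (bin₀₁ (k + l + (k + m)) k * bin (k + m) k)
    ≡ suc (l + k + m) * (bin (k + l + (k + m)) k * bin₁₁ (k + m) k)
ballot-identity zero l zero = solve 1 (λ l →
  (con 1 :+ l) :* con 1 :* con 1 :+ (con 1 :+ (l :+ con 0 :+ con 0)) :* (con 0 :* con 1)
    := (con 1 :+ (l :+ con 0 :+ con 0)) :* (con 1 :* con 1)) refl l
ballot-identity zero l (suc m) = solve 2 (λ l m →
  (con 1 :+ l) :* con 1 :* con 0 :+ (con 1 :+ (l :+ con 0 :+ (con 1 :+ m))) :* (con 0 :* con 1)
    := (con 1 :+ (l :+ con 0 :+ (con 1 :+ m))) :* (con 1 :* con 0)) refl l m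
ballot-identity (suc k) l m = begin
  suc l * B * β + suc d * (A * c)          ≡⟨ cong (suc l * B * β +_) Ac≡Bβ ⟩
  suc l * B * β + B * (suc (k + m) * β)    ≡⟨ solve 5 (λ l k m B β →
                                                 (con 1 :+ l) :* B :* β :+ B :* ((con 1 :+ (k :+ m)) :* β)
                                                   := (con 1 :+ (l :+ (con 1 :+ k) :+ m)) :* (B :* β)) refl l k m B β ⟩
  suc d * (B * β)                          ∎
  where
  N = suc k + l + (suc k + m)
  d = l + suc k + m
  A = bin N k
  B = bin N (suc k)
  c = bin (suc (k + m)) (suc k)
  β = bin (k + m) k

  N≡d+1+k : N ≡ d + suc k
  N≡d+1+k = solve 3 (λ k l m → (con 1 :+ k) :+ l :+ ((con 1 :+ k) :+ m)
                              := l :+ (con 1 :+ k) :+ m :+ (con 1 :+ k)) refl k l m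

  Ac≡Bβ : suc d * (A * c) ≡ B * (suc (k + m) * β)
  Ac≡Bβ = begin
    suc d * (A * c)            ≡⟨ *-assoc (suc d) A c ⟨
    suc d * A * c
      ≡⟨ cong (_* c) (subst (λ n → suc d * bin n k ≡ suc k * bin n (suc k)) (sym N≡d+1+k) (lower-absorption d k)) ⟩
    suc k * B * c              ≡⟨ solve 3 (λ x y z → x :* y :* z := y :* (x :* z)) refl (suc k) B c ⟩
    B * (suc k * c)            ≡⟨ cong (B *_) (absorption (k + m) k) ⟩
    B * (suc (k + m) * β)      ∎

delay : ℕ → (ℕ → ℕ) → ℕ → ℕ
delay zero    f n       = f n
delay (suc e) f zero    = 0
delay (suc e) f (suc n) = delay e f n

delay-< : ∀ {e n} f → n < e → delay e f n ≡ 0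
delay-< {suc e} {zero}  f _         = refl
delay-< {suc e} {suc n} f (s≤s n<e) = delay-< f n<e

delay-elim : ∀ (P : ℕ → Set) e f n → (n < e → P 0) → (∀ m → e + m ≡ n → P (f m)) → P (delay e f n)
delay-elim P zero    f n       P0 Pf = Pf n refl
delay-elim P (suc e) f zero    P0 Pf = P0 (s≤s z≤n)
delay-elim P (suc e) f (suc n) P0 Pf = delay-elim P e f n (P0 ∘ s≤s) (λ m e+m≡n → Pf m (cong suc e+m≡n))

delay-cong : ∀ e {f g} n → (∀ q → e + q ≡ n → f q ≡ g q) → delay e f n ≡ delay e g n
delay-cong zero    n       f≡g = f≡g n refl
delay-cong (suc e) zero    f≡g = refl
delay-cong (suc e) (suc n) f≡g = delay-cong e n (λ q e+q≡n → f≡g q (cong suc e+q≡n))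

delay-+ : ∀ e e′ f n → delay (e + e′) f n ≡ delay e (delay e′ f) n
delay-+ zero    e′ f n       = refl
delay-+ (suc e) e′ f zero    = refl
delay-+ (suc e) e′ f (suc n) = delay-+ e e′ f n

delay-suc : ∀ e f n → delay (suc e) f n ≡ delay e (delay 1 f) n
delay-suc zero    f n       = refl
delay-suc (suc e) f zero    = refl
delay-suc (suc e) f (suc n) = delay-suc e f n

delay-sum : ∀ e f g n → delay e f n + delay e g n ≡ delay e (λ q → f q + g q) n
delay-sum zero    f g n       = refl
delay-sum (suc e) f g zero    = refl
delay-sum (suc e) f g (suc n) = delay-sum e f g n

-- Coefficient arrays F l n k are indexed by the degrees in y, t and x; t* and x* multiply by t and x.
family : (ℕ → ℕ → ℕ) → (ℕ → ℕ → ℕ) → ℕ → ℕ → ℕ → ℕ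
family A B l n k = delay (k + l) (λ q → A n k * B q k) n

family-order : ∀ A B {l n} k → n < l → family A B l n k ≡ 0
family-order A B {l} k n<l = delay-< _ (<-≤-trans n<l (m≤n+m l k))

t* x* : (ℕ → ℕ → ℕ) → ℕ → ℕ → ℕ
t* f zero    k = 0
t* f (suc n) k = f n k
x* f n zero    = 0
x* f n (suc k) = f n k

ℕ-Recurrence : (ℕ → ℕ → ℕ → ℕ) → Set
ℕ-Recurrence F = ∀ l n k →
  F (suc (suc l)) n k + x* (t* (F (suc (suc l)))) n k + t* (F l) n k ≡ F (suc l) n k + t* (F (suc l)) n k

family-recurrence : ∀ {A B} → IsPascal A → (∀ n → A (suc n) 0 ≡ A n 0) →
                    IsPascal B → (∀ k → B 0 (suc k) ≡ 0) → ℕ-Recurrence (family A B)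
family-recurrence pA A-0 pB B-0 l zero    zero    = refl
family-recurrence pA A-0 pB B-0 l zero    (suc k) = refl
family-recurrence {A} {B} pA A-0 pB B-0 l (suc n) zero rewrite A-0 n =
  trans (cong (_+ delay l φ n) (+-identityʳ _)) (+-comm (delay (suc l) φ n) (delay l φ n))
  where
  φ : ℕ → ℕ
  φ q = A n 0 * B q 0
family-recurrence {A} {B} pA A-0 pB B-0 l (suc n) (suc k)
  rewrite +-suc k (suc l) | sym (+-suc k l) = begin
    delay (suc e) φ₁ n + delay (suc e) φ₂ n + delay e φ₃ n
      ≡⟨ cong₂ (λ x y → x + y + delay e φ₃ n) (delay-suc e φ₁ n) (delay-suc e φ₂ n) ⟩
    delay e (delay 1 φ₁) n + delay e (delay 1 φ₂) n + delay e φ₃ n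
      ≡⟨ trans (cong (_+ delay e φ₃ n) (delay-sum e _ _ n)) (delay-sum e _ _ n) ⟩
    delay e (λ q → delay 1 φ₁ q + delay 1 φ₂ q + φ₃ q) n
      ≡⟨ delay-cong e n (λ q _ → pointwise q) ⟩
    delay e (λ q → φ₁ q + delay 1 φ₃ q) n
      ≡⟨ delay-sum e _ _ n ⟨
    delay e φ₁ n + delay e (delay 1 φ₃) n
      ≡⟨ cong (delay e φ₁ n +_) (delay-suc e φ₃ n) ⟨
    delay e φ₁ n + delay (suc e) φ₃ n ∎
  where
  e = k + suc l
  φ₁ φ₂ φ₃ : ℕ → ℕ
  φ₁ q = A (suc n) (suc k) * B q (suc k)
  φ₂ q = A n k * B q k
  φ₃ q = A n (suc k) * B q (suc k)
  pointwise : ∀ q → delay 1 φ₁ q + delay 1 φ₂ q + φ₃ q ≡ φ₁ q + delay 1 φ₃ q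
  pointwise zero    rewrite B-0 k =
    trans (*-zeroʳ (A n (suc k))) (sym (trans (+-identityʳ _) (*-zeroʳ (A (suc n) (suc k)))))
  pointwise (suc r) rewrite pA n k | pB r k =
    solve 4 (λ a₁ a₀ b₁ b₀ → (a₁ :+ a₀) :* b₁ :+ a₀ :* b₀ :+ a₁ :* (b₁ :+ b₀) := (a₁ :+ a₀) :* (b₁ :+ b₀) :+ a₁ :* b₁)
          refl (A n (suc k)) (A n k) (B r (suc k)) (B r k)

G H : ℕ → ℕ → ℕ → ℕ
G = family bin bin₁₁
H = family bin₀₁ bin

G-recurrence : ℕ-Recurrence G
G-recurrence = family-recurrence {bin} {bin₁₁} bin-pascal (λ _ → refl) bin₁₁-pascal (λ _ → refl)

H-recurrence : ℕ-Recurrence H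
H-recurrence = family-recurrence {bin₀₁} {bin} bin₀₁-pascal (λ _ → refl) bin-pascal (λ _ → refl)

δ : ℕ → ℕ → ℕ
δ zero    zero    = 1
δ zero    (suc k) = 0
δ (suc n) k       = 0

GH-initial-step : ∀ {n} k s → k + suc s ≡ n →
    bin (suc n) (suc k) * bin s k + bin n (suc k) * bin₁₁ s (suc k)
      + (bin (suc n) k * bin s (suc k) + bin₀₁ n k * bin s k)
  ≡ bin (suc n) (suc k) * bin₁₁ s (suc k) + bin n k * bin₁₁ s k
      + (bin (suc n) k * bin (suc s) (suc k) + bin n k * bin s (suc k))
GH-initial-step {n} k s k+1+s≡n = begin
  (b + a) * f + a * c + (bin (suc n) k * e + g * f)
    ≡⟨ cong (λ z → (b + a) * f + a * c + (z * e + g * f)) (bin₀₁-pascal n k) ⟩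
  (b + a) * f + a * c + ((b + g) * e + g * f)
    ≡⟨ solve 6 (λ a b c e f g → (b :+ a) :* f :+ a :* c :+ ((b :+ g) :* e :+ g :* f)
                                := a :* f :+ (b :* f :+ a :* c :+ b :* e :+ g :* e :+ g :* f)) refl a b c e f g ⟩
  a * f + (b * f + a * c + b * e + g * e + g * f)
    ≡⟨ cong (_+ (b * f + a * c + b * e + g * e + g * f)) (bin-ratio s k k+1+s≡n) ⟩
  b * (f + e) + (b * f + a * c + b * e + g * e + g * f)
    ≡⟨ solve 6 (λ a b c e f g → b :* (f :+ e) :+ (b :* f :+ a :* c :+ b :* e :+ g :* e :+ g :* f)
                                := b :* f :+ (a :* c :+ (b :+ g) :* (f :+ e) :+ b :* e)) refl a b c e f g ⟩
  b * f + (a * c + (b + g) * (f + e) + b * e)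
    ≡⟨ cong (λ z → b * z + (a * c + (b + g) * (f + e) + b * e)) (bin₁₁-pascal s k) ⟩
  b * (c + d) + (a * c + (b + g) * (f + e) + b * e)
    ≡⟨ solve 7 (λ a b c d e f g → b :* (c :+ d) :+ (a :* c :+ (b :+ g) :* (f :+ e) :+ b :* e)
                                  := (b :+ a) :* c :+ b :* d :+ ((b :+ g) :* (f :+ e) :+ b :* e)) refl a b c d e f g ⟩
  (b + a) * c + b * d + ((b + g) * (f + e) + b * e)
    ≡⟨ cong (λ z → (b + a) * c + b * d + (z * (f + e) + b * e)) (bin₀₁-pascal n k) ⟨
  (b + a) * c + b * d + (bin (suc n) k * (f + e) + b * e) ∎
  where
  a = bin n (suc k)
  b = bin n k
  g = bin₀₁ n k
  c = bin₁₁ s (suc k)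
  d = bin₁₁ s k
  e = bin s (suc k)
  f = bin s k

GH-initial : ∀ n k → G 0 n k + t* (G 0) n k + (H 1 n k + x* (t* (H 1)) n k)
                   ≡ δ n k + (G 1 n k + x* (t* (G 1)) n k) + (H 0 n k + t* (H 0) n k)
GH-initial zero    zero    = refl
GH-initial zero    (suc k) = refl
GH-initial (suc n) zero    = sym (+-identityʳ _)
GH-initial (suc n) (suc k) rewrite +-identityʳ k | +-comm k 1 = begin
  delay k φ n + delay (suc k) ψ₁ n + (delay (suc k) ψ₂ n + delay (suc k) ψ₃ n)
    ≡⟨ cong₂ (λ x y → delay k φ n + x + y) (delay-suc k ψ₁ n) (cong₂ _+_ (delay-suc k ψ₂ n) (delay-suc k ψ₃ n)) ⟩
  delay k φ n + delay k (delay 1 ψ₁) n + (delay k (delay 1 ψ₂) n + delay k (delay 1 ψ₃) n)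
    ≡⟨ sum₄ φ (delay 1 ψ₁) (delay 1 ψ₂) (delay 1 ψ₃) ⟩
  delay k (λ q → φ q + delay 1 ψ₁ q + (delay 1 ψ₂ q + delay 1 ψ₃ q)) n
    ≡⟨ delay-cong k n pointwise ⟩
  delay k (λ q → delay 1 φ q + delay 1 χ q + (ψ₂ q + delay 1 ψ₄ q)) n
    ≡⟨ sum₄ (delay 1 φ) (delay 1 χ) ψ₂ (delay 1 ψ₄) ⟨
  delay k (delay 1 φ) n + delay k (delay 1 χ) n + (delay k ψ₂ n + delay k (delay 1 ψ₄) n)
    ≡⟨ cong₂ (λ x y → x + y + (delay k ψ₂ n + delay k (delay 1 ψ₄) n)) (delay-suc k φ n) (delay-suc k χ n) ⟨
  delay (suc k) φ n + delay (suc k) χ n + (delay k ψ₂ n + delay k (delay 1 ψ₄) n)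
    ≡⟨ cong (λ x → delay (suc k) φ n + delay (suc k) χ n + (delay k ψ₂ n + x)) (delay-suc k ψ₄ n) ⟨
  delay (suc k) φ n + delay (suc k) χ n + (delay k ψ₂ n + delay (suc k) ψ₄ n) ∎
  where
  φ ψ₁ ψ₂ ψ₃ χ ψ₄ : ℕ → ℕ
  φ  q = bin (suc n) (suc k) * bin₁₁ q (suc k)
  ψ₁ q = bin n (suc k) * bin₁₁ q (suc k)
  ψ₂ q = bin (suc n) k * bin q (suc k)
  ψ₃ q = bin₀₁ n k * bin q k
  χ  q = bin n k * bin₁₁ q k
  ψ₄ q = bin n k * bin q (suc k)

  sum₄ : ∀ f₁ f₂ f₃ f₄ → delay k f₁ n + delay k f₂ n + (delay k f₃ n + delay k f₄ n)
                       ≡ delay k (λ q → f₁ q + f₂ q + (f₃ q + f₄ q)) n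
  sum₄ f₁ f₂ f₃ f₄ = trans (cong₂ _+_ (delay-sum k f₁ f₂ n) (delay-sum k f₃ f₄ n)) (delay-sum k _ _ n)

  pointwise : ∀ q → k + q ≡ n → φ q + delay 1 ψ₁ q + (delay 1 ψ₂ q + delay 1 ψ₃ q)
                               ≡ delay 1 φ q + delay 1 χ q + (ψ₂ q + delay 1 ψ₄ q)
  pointwise zero    _        = trans (+-identityʳ _) (trans (+-identityʳ _) (trans (*-zeroʳ (bin (suc n) (suc k)))
                                 (sym (trans (+-identityʳ _) (*-zeroʳ (bin (suc n) k))))))
  pointwise (suc s) k+1+s≡n = GH-initial-step k s k+1+s≡n

family-window : ∀ A B k l n f → (∀ {q} → q < k → B q k ≡ 0) →
                (∀ m → f m ≡ A (k + l + (k + m)) k * B (k + m) k) →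
                delay (2 * k + l) f n ≡ family A B l n k
family-window A B k l n f B-below f≡ = begin
  delay (2 * k + l) f n
    ≡⟨ cong (λ e → delay e f n) (solve 2 (λ k l → con 2 :* k :+ l := k :+ l :+ k) refl k l) ⟩
  delay (k + l + k) f n        ≡⟨ delay-+ (k + l) k f n ⟩
  delay (k + l) (delay k f) n  ≡⟨ delay-cong (k + l) n window ⟩
  family A B l n k             ∎
  where
  window : ∀ q → k + l + q ≡ n → delay k f q ≡ A n k * B q k
  window q k+l+q≡n = delay-elim (λ v → v ≡ A n k * B q k) k f q
    (λ q<k → sym (trans (cong (A n k *_) (B-below q<k)) (*-zeroʳ (A n k))))
    (λ m k+m≡q → trans (f≡ m)
      (cong₂ (λ n′ q′ → A n′ k * B q′ k) (trans (cong (_+_ (k + l)) k+m≡q) k+l+q≡n) k+m≡q))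

GB-coefficient GA-numerator : ℕ → ℕ → ℕ → ℕ
GB-coefficient k l m = ((2 * k + l + m) C k) * binomL k m
GA-numerator   k l m = (suc l * ((l + 2 * k + m) C k)) * binomL k m

GB-coefficient≡ : ∀ k l m → GB-coefficient k l m ≡ bin (k + l + (k + m)) k * bin₁₁ (k + m) k
GB-coefficient≡ k l m = cong₂ _*_
  (trans (cong (_C k) (solve 3 (λ k l m → con 2 :* k :+ l :+ m := k :+ l :+ (k :+ m)) refl k l m)) (sym (bin≡C _ k)))
  (binomL≡bin₁₁ k m)

GA-numerator≡ : ∀ k l m → GA-numerator k l m ≡ suc l * bin (k + l + (k + m)) k * bin₁₁ (k + m) k
GA-numerator≡ k l m = cong₂ (λ b b₁₁ → suc l * b * b₁₁)
  (trans (cong (_C k) (solve 3 (λ k l m → l :+ con 2 :* k :+ m := k :+ l :+ (k :+ m)) refl k l m)) (sym (bin≡C _ k)))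
  (binomL≡bin₁₁ k m)

open import Data.Bool using (true; false)
open import Data.Integer as ℤ using (+_)
import Data.Integer.Properties as ℤP
open import Data.Rational as ℚ using (ℚ; 0ℚ; _/_)
import Data.Rational.Properties as ℚP
open import Data.Rational.Unnormalised using (mkℚᵘ; *≡*)
import Data.Rational.Unnormalised.Properties as ℚᵘP
import Algebra.Properties.Group ℚP.+-0-group as ℚ-group
import Algebra.Properties.CommutativeSemigroup (CommutativeRing.+-commutativeSemigroup ℚP.+-*-commutativeRing) as ℚ-+

ι : ℕ → ℚ
ι n = + n / 1

fraction-+ : ∀ X d Z Y → X + suc d * Z ≡ suc d * Y → + X / suc d ℚ.+ ι Z ≡ ι Y
fraction-+ X d Z Y eq = ℚP.toℚᵘ-injective (ℚᵘP.≃-trans (ℚP.toℚᵘ-homo-+ (+ X / suc d) (ι Z))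
  (ℚᵘP.≃-trans (ℚᵘP.+-cong (ℚP.toℚᵘ-fromℚᵘ (mkℚᵘ (+ X) d)) (ℚP.toℚᵘ-fromℚᵘ (mkℚᵘ (+ Z) 0)))
  (ℚᵘP.≃-trans (*≡* cross-multiplied) (ℚᵘP.≃-sym (ℚP.toℚᵘ-fromℚᵘ (mkℚᵘ (+ Y) 0))))))
  where
  cross-multiplied : (+ X ℤ.* + 1 ℤ.+ + Z ℤ.* + suc d) ℤ.* + 1 ≡ + Y ℤ.* + (suc d * 1)
  cross-multiplied = begin
    (+ X ℤ.* + 1 ℤ.+ + Z ℤ.* + suc d) ℤ.* + 1  ≡⟨ ℤP.*-identityʳ _ ⟩
    + X ℤ.* + 1 ℤ.+ + Z ℤ.* + suc d            ≡⟨ cong₂ ℤ._+_ (ℤP.*-identityʳ (+ X)) (sym (ℤP.pos-* Z (suc d))) ⟩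
    + X ℤ.+ + (Z * suc d)                      ≡⟨ ℤP.pos-+ X (Z * suc d) ⟨
    + (X + Z * suc d)                          ≡⟨ cong +_ (trans (cong (_+_ X) (*-comm Z (suc d))) eq) ⟩
    + (suc d * Y)
      ≡⟨ cong +_ (trans (*-comm (suc d) Y) (cong (Y *_) (sym (*-identityʳ (suc d))))) ⟩
    + (Y * (suc d * 1))                        ≡⟨ ℤP.pos-* Y (suc d * 1) ⟩
    + Y ℤ.* + (suc d * 1)                      ∎

ι-+ : ∀ a b → ι (a + b) ≡ ι a ℚ.+ ι b
ι-+ a b = sym (fraction-+ a 0 b (a + b) (trans (cong (_+_ a) (*-identityˡ b)) (sym (*-identityˡ (a + b)))))

at-ι : ∀ n e f → at n e (ι ∘ f) ≡ ι (delay e f n)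
at-ι n       zero          f = refl
at-ι zero    (suc e)       f = refl
at-ι (suc n) (suc zero)    f = at-ι n zero f
at-ι (suc n) (suc (suc e)) f = at-ι n (suc e) f

at-+ : ∀ n e f g → at n e f ℚ.+ at n e g ≡ at n e (λ m → f m ℚ.+ g m)
at-+ n e f g with e ≤ᵇ n
... | true  = refl
... | false = refl

at-cong : ∀ n e {f g} → (∀ m → f m ≡ g m) → at n e f ≡ at n e g
at-cong n e f≡g with e ≤ᵇ n
... | true  = f≡g (n ∸ e)
... | false = refl

ℚ-commutativeSemiring : CommutativeSemiring 0ℓ 0ℓ
ℚ-commutativeSemiring = CommutativeRing.commutativeSemiring ℚP.+-*-commutativeRing

module ℚ[[x]] = PowerSeries ℚ-commutativeSemiring
module ℚ[[x]][[t]] = PowerSeries ℚ[[x]].commutativeSemiring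

module S = CommutativeSemiring ℚ[[x]][[t]].commutativeSemiring
open ℚ[[x]][[t]] using (Series; _≋_; _+ₛ_; _*ₛ_; 1ₛ; shift; HasOrder) renaming (X to t)

x : ℚ[[x]].Series
x = ℚ[[x]].X

open LinearRecurrence ℚ[[x]].commutativeSemiring (ℚ[[x]].+ₛ-cancelʳ ℚ-group.∙-cancelʳ) x

embed : (ℕ → ℕ → ℕ → ℕ) → ℕ → Series
embed F l n k = ι (F l n k)

shift-embed : ∀ F l n k → shift (embed F l) n k ≡ ι (t* (F l) n k)
shift-embed F l zero    k = refl
shift-embed F l (suc n) k = refl

shift²-embed : ∀ F l n k → ℚ[[x]].shift (shift (embed F l) n) k ≡ ι (x* (t* (F l)) n k)
shift²-embed F l n       zero    = refl
shift²-embed F l zero    (suc k) = refl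
shift²-embed F l (suc n) (suc k) = refl

t-*ₛ-embed : ∀ F l n k → (t *ₛ embed F l) n k ≡ ι (t* (F l) n k)
t-*ₛ-embed F l n k = trans (ℚ[[x]][[t]].X-*ₛ (embed F l) n k) (shift-embed F l n k)

V-*ₛ-embed : ∀ F l n k → (V *ₛ embed F l) n k ≡ ι (F l n k + t* (F l) n k)
V-*ₛ-embed F l n k = trans (V-*ₛ-coeff (embed F l) n k)
  (trans (cong (ι (F l n k) ℚ.+_) (shift-embed F l n k)) (sym (ι-+ (F l n k) (t* (F l) n k))))

U-*ₛ-embed : ∀ F l n k → (U *ₛ embed F l) n k ≡ ι (F l n k + x* (t* (F l)) n k)
U-*ₛ-embed F l n k = trans (U-*ₛ-coeff (embed F l) n k)
  (trans (cong (ι (F l n k) ℚ.+_) (trans (ℚ[[x]].X-*ₛ (shift (embed F l) n) k) (shift²-embed F l n k)))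
         (sym (ι-+ (F l n k) (x* (t* (F l)) n k))))

embed-recurrence : ∀ {F} → ℕ-Recurrence F → Recurrence (embed F)
embed-recurrence {F} rec l n k = begin
  (U *ₛ embed F (suc (suc l))) n k ℚ.+ (t *ₛ embed F l) n k
    ≡⟨ cong₂ ℚ._+_ (U-*ₛ-embed F (suc (suc l)) n k) (t-*ₛ-embed F l n k) ⟩
  ι (F (suc (suc l)) n k + x* (t* (F (suc (suc l)))) n k) ℚ.+ ι (t* (F l) n k)
    ≡⟨ ι-+ (F (suc (suc l)) n k + x* (t* (F (suc (suc l)))) n k) (t* (F l) n k) ⟨
  ι (F (suc (suc l)) n k + x* (t* (F (suc (suc l)))) n k + t* (F l) n k)
    ≡⟨ cong ι (rec l n k) ⟩
  ι (F (suc l) n k + t* (F (suc l)) n k)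
    ≡⟨ V-*ₛ-embed F (suc l) n k ⟨
  (V *ₛ embed F (suc l)) n k ∎

embed-order : ∀ A B l → HasOrder l (embed (family A B) l)
embed-order A B l n n<l k = cong ι (family-order A B k n<l)

ι-δ : ∀ n k → ι (δ n k) ≡ 1ₛ n k
ι-δ zero    zero    = refl
ι-δ zero    (suc k) = refl
ι-δ (suc n) k       = refl

embed-initial : V *ₛ embed G 0 +ₛ U *ₛ embed H 1 ≋ 1ₛ +ₛ U *ₛ embed G 1 +ₛ V *ₛ embed H 0
embed-initial n k = begin
  (V *ₛ embed G 0) n k ℚ.+ (U *ₛ embed H 1) n k
    ≡⟨ cong₂ ℚ._+_ (V-*ₛ-embed G 0 n k) (U-*ₛ-embed H 1 n k) ⟩
  ι (G 0 n k + t* (G 0) n k) ℚ.+ ι (H 1 n k + x* (t* (H 1)) n k)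
    ≡⟨ ι-+ (G 0 n k + t* (G 0) n k) (H 1 n k + x* (t* (H 1)) n k) ⟨
  ι (G 0 n k + t* (G 0) n k + (H 1 n k + x* (t* (H 1)) n k))
    ≡⟨ cong ι (GH-initial n k) ⟩
  ι (δ n k + (G 1 n k + x* (t* (G 1)) n k) + (H 0 n k + t* (H 0) n k))
    ≡⟨ trans (ι-+ (δ n k + Gₓ) Hₜ) (cong (ℚ._+ ι Hₜ) (ι-+ (δ n k) Gₓ)) ⟩
  ι (δ n k) ℚ.+ ι (G 1 n k + x* (t* (G 1)) n k) ℚ.+ ι (H 0 n k + t* (H 0) n k)
    ≡⟨ cong₂ ℚ._+_ (cong₂ ℚ._+_ (ι-δ n k) (sym (U-*ₛ-embed G 1 n k))) (sym (V-*ₛ-embed H 0 n k)) ⟩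
  1ₛ n k ℚ.+ (U *ₛ embed G 1) n k ℚ.+ (V *ₛ embed H 0) n k ∎
  where
  Gₓ = G 1 n k + x* (t* (G 1)) n k
  Hₜ = H 0 n k + t* (H 0) n k

-- Defs indexes coefficients by the degrees in x, y, t; slice F j is the y^j part as a series in t.
slice : Defs.Series → ℕ → Series
slice F j n i = F i j n

GB≡G : ∀ l → slice GB l ≋ embed G l
GB≡G l n k = trans (at-ι n (2 * k + l) (GB-coefficient k l))
  (cong ι (family-window bin bin₁₁ k l n _ bin₁₁-below (GB-coefficient≡ k l)))

GA+H≡G : ∀ l → slice GA l +ₛ embed H l ≋ embed G l
GA+H≡G l n k = begin
  GA k l n ℚ.+ ι (H l n k)
    ≡⟨ cong (GA k l n ℚ.+_) (trans (at-ι n e h) (cong ι (family-window bin₀₁ bin k l n h n<k⇒bin≡0 (λ _ → refl)))) ⟨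
  GA k l n ℚ.+ at n e (ι ∘ h)
    ≡⟨ at-+ n e (λ m → + (GA-numerator k l m) / suc (l + k + m)) (ι ∘ h) ⟩
  at n e (λ m → + (GA-numerator k l m) / suc (l + k + m) ℚ.+ ι (h m))
    ≡⟨ at-cong n e (λ m → fraction-+ (GA-numerator k l m) (l + k + m) (h m) (GB-coefficient k l m) (ballot m)) ⟩
  at n e (ι ∘ GB-coefficient k l)
    ≡⟨ GB≡G l n k ⟩
  ι (G l n k) ∎
  where
  e = 2 * k + l
  h : ℕ → ℕ
  h m = bin₀₁ (k + l + (k + m)) k * bin (k + m) k
  ballot : ∀ m → GA-numerator k l m + suc (l + k + m) * h m ≡ suc (l + k + m) * GB-coefficient k l m
  ballot m = trans (cong (_+ suc (l + k + m) * h m) (GA-numerator≡ k l m))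
    (trans (ballot-identity k l m) (cong (suc (l + k + m) *_) (sym (GB-coefficient≡ k l m))))

sumTo-cong : ∀ n {f g} → (∀ i → f i ≡ g i) → sumTo n f ≡ sumTo n g
sumTo-cong zero    f≡g = f≡g 0
sumTo-cong (suc n) f≡g = cong₂ ℚ._+_ (sumTo-cong n f≡g) (f≡g (suc n))

sumTo-+ : ∀ n f g → sumTo n f ℚ.+ sumTo n g ≡ sumTo n (λ i → f i ℚ.+ g i)
sumTo-+ zero    f g = refl
sumTo-+ (suc n) f g = trans (ℚ-+.interchange (sumTo n f) (f (suc n)) (sumTo n g) (g (suc n)))
                            (cong (ℚ._+ (f (suc n) ℚ.+ g (suc n))) (sumTo-+ n f g))

sumTo-swap : ∀ m n (f : ℕ → ℕ → ℚ) →
             sumTo m (λ a → sumTo n (f a)) ≡ sumTo n (λ c → sumTo m (λ a → f a c))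
sumTo-swap zero    n f = refl
sumTo-swap (suc m) n f = trans (cong (ℚ._+ sumTo n (f (suc m))) (sumTo-swap m n f))
                               (sumTo-+ n (λ c → sumTo m (λ a → f a c)) (f (suc m)))

sumTo-zero : ∀ n {f} → (∀ i → f i ≡ 0ℚ) → sumTo n f ≡ 0ℚ
sumTo-zero zero    f≡0 = f≡0 0
sumTo-zero (suc n) f≡0 = trans (cong₂ ℚ._+_ (sumTo-zero n f≡0) (f≡0 (suc n))) (ℚP.+-identityˡ 0ℚ)

sumTo-head : ∀ n {f} → (∀ i → f (suc i) ≡ 0ℚ) → sumTo n f ≡ f 0
sumTo-head zero    f₊≡0 = refl
sumTo-head (suc n) f₊≡0 = trans (cong₂ ℚ._+_ (sumTo-head n f₊≡0) (f₊≡0 n)) (ℚP.+-identityʳ _)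

∑≤≡sumTo : ∀ n f → ℚ[[x]].∑≤ n f ≡ sumTo n f
∑≤≡sumTo zero    f = refl
∑≤≡sumTo (suc n) f = cong (ℚ._+ f (suc n)) (∑≤≡sumTo n f)

∑≤-apply : ∀ n h i → ℚ[[x]][[t]].∑≤ n h i ≡ sumTo n (λ c → h c i)
∑≤-apply zero    h i = refl
∑≤-apply (suc n) h i = cong (ℚ._+ h (suc n) i) (∑≤-apply n h i)

⋆-slice : ∀ F G → (∀ a b c → F a (suc b) c ≡ 0ℚ) → ∀ i j n → (F ⋆ G) i j n ≡ (slice F 0 *ₛ slice G j) n i
⋆-slice F G F-free-of-y i j n = begin
  (F ⋆ G) i j n
    ≡⟨ sumTo-cong i (λ a → sumTo-head j (λ b → sumTo-zero n (λ c →
         trans (cong (ℚ._* G (i ∸ a) (j ∸ suc b) (n ∸ c)) (F-free-of-y a b c))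
               (ℚP.*-zeroˡ (G (i ∸ a) (j ∸ suc b) (n ∸ c)))))) ⟩
  sumTo i (λ a → sumTo n (λ c → F a 0 c ℚ.* G (i ∸ a) j (n ∸ c)))
    ≡⟨ sumTo-swap i n _ ⟩
  sumTo n (λ c → sumTo i (λ a → F a 0 c ℚ.* G (i ∸ a) j (n ∸ c)))
    ≡⟨ sumTo-cong n (λ c → trans (sym (∑≤≡sumTo i _))
                                 (sym (ℚ[[x]].*ₛ-coeff (slice F 0 c) (slice G j (n ∸ c)) i))) ⟩
  sumTo n (λ c → (slice F 0 c ℚ[[x]].*ₛ slice G j (n ∸ c)) i)
    ≡⟨ ∑≤-apply n _ i ⟨
  ℚ[[x]][[t]].∑≤ n (λ c → slice F 0 c ℚ[[x]].*ₛ slice G j (n ∸ c)) i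
    ≡⟨ ℚ[[x]][[t]].*ₛ-coeff (slice F 0) (slice G j) n i ⟨
  (slice F 0 *ₛ slice G j) n i ∎

GB[i,1+j,0]≡0 : ∀ i j → GB i (suc j) 0 ≡ 0ℚ
GB[i,1+j,0]≡0 i j = trans (GB≡G (suc j) 0 i) (cong ι (family-order bin bin₁₁ i (s≤s z≤n)))

gB≡GB : ∀ k n → gB k 0 n ≡ GB k 0 n
gB≡GB k n = trans (cong (λ e → at n e (λ m → ι (((2 * k + m) C k) * binomL k m)))
                        (sym (+-identityʳ (2 * k))))
  (at-cong n (2 * k + 0) (λ m → cong (λ a → ι (((a + m) C k) * binomL k m)) (sym (+-identityʳ (2 * k)))))

gA≡GA : ∀ k n → gA k 0 n ≡ GA k 0 n
gA≡GA k n = trans (cong (λ e → at n e (λ m → + (((2 * k + m) C k) * binomL k m) / suc (k + m)))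
                        (sym (+-identityʳ (2 * k))))
  (at-cong n (2 * k + 0) (λ m → cong (λ a → + (a * binomL k m) / suc (k + m))
                                     (sym (*-identityˡ ((2 * k + m) C k)))))

GB-identity-from-slices : ∀ F G → (∀ a b c → F a (suc b) c ≡ 0ℚ) →
                          (∀ l → slice GB (suc l) ≋ t *ₛ (slice F 0 *ₛ slice G l)) →
                          ∀ i j n → GB i j n ≡ (gB ⊕ yt (F ⋆ G)) i j n
GB-identity-from-slices F G F-free-of-y GB-step i zero n =
  trans (sym (gB≡GB i n)) (sym (ℚP.+-identityʳ _))
GB-identity-from-slices F G F-free-of-y GB-step i (suc j) zero =
  trans (GB[i,1+j,0]≡0 i j) (sym (ℚP.+-identityˡ 0ℚ))
GB-identity-from-slices F G F-free-of-y GB-step i (suc j) (suc n) = begin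
  GB i (suc j) (suc n)                          ≡⟨ GB-step j (suc n) i ⟩
  (t *ₛ (slice F 0 *ₛ slice G j)) (suc n) i     ≡⟨ ℚ[[x]][[t]].X-*ₛ _ (suc n) i ⟩
  (slice F 0 *ₛ slice G j) n i                  ≡⟨ ⋆-slice F G F-free-of-y i j n ⟨
  (F ⋆ G) i j n                                 ≡⟨ ℚP.+-identityˡ _ ⟨
  0ℚ ℚ.+ (F ⋆ G) i j n                          ∎

GA-recurrence : Recurrence (slice GA)
GA-recurrence = recurrence-cancel {slice GA} {embed H} {embed G} GA+H≡G
                  (embed-recurrence H-recurrence) (embed-recurrence G-recurrence)

GA-orders : HasOrders (slice GA)
GA-orders l = HasOrder-cancel {f = slice GA l} (GA+H≡G l)
                (embed-order bin₀₁ bin l) (embed-order bin bin₁₁ l)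

GA-initial : V *ₛ slice GA 0 ≋ 1ₛ +ₛ U *ₛ slice GA 1
GA-initial = initial-cancel {slice GA} {embed H} {embed G} GA+H≡G embed-initial

GB-step-gA : ∀ l → slice GB (suc l) ≋ t *ₛ (slice gA 0 *ₛ slice GB l)
GB-step-gA l = S.trans (GB≡G (suc l))
  (S.trans (geometric GA-recurrence GA-orders GA-initial
                      (embed-recurrence G-recurrence) (embed-order bin bin₁₁) l)
  (S.trans (S.*-assoc t (slice GA 0) (embed G l))
           (S.*-congˡ (S.*-cong (λ n k → sym (gA≡GA k n)) (S.sym (GB≡G l))))))

GB-step-gB : ∀ l → slice GB (suc l) ≋ t *ₛ (slice gB 0 *ₛ slice GA l)
GB-step-gB l = S.trans (GB≡G (suc l))
  (S.trans (geometric-exchange GA-recurrence GA-orders GA-initial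
                               (embed-recurrence G-recurrence) (embed-order bin bin₁₁) l)
           (S.*-congˡ (S.*-congʳ (S.sym (S.trans (λ n k → gB≡GB k n) (GB≡G 0))))))

proposition5 : (∀ i j n → GB i j n ≡ (gB ⊕ yt (gA ⋆ GB)) i j n)
    × (∀ i j n → GB i j n ≡ (gB ⊕ yt (gB ⋆ GA)) i j n)
proposition5 = GB-identity-from-slices gA GB (λ _ _ _ → refl) GB-step-gA
             , GB-identity-from-slices gB GA (λ _ _ _ → refl) GB-step-gB
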